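{- Let $\mathcal{S}$ be an expressivity situation and $x\colon X\to BX$ a $B$-coalgebra. Assume that the chain $\top\sqsupseteq(x^*\circ\overline{B}^{\underline{\Omega},\tau})(\top)\sqsupseteq(x^*\circ\overline{B}^{\underline{\Omega},\tau})^2(\top)\sqsupseteq\cdots$ in $\mathcal{E}_X$ stabilizes after $\omega$ steps, i.e. $\bigwedge_{i<\omega}(x^*\circ\overline{B}^{\underline{\Omega},\tau})^i(\top)$ is a fixed point of $x^*\circ\overline{B}^{\underline{\Omega},\tau}$. If for each $i\in\mathbb{N}$ the set $\{[\![\varphi]\!]_x\mid\varphi\in L_{\mathcal{S}},\ \mathrm{depth}(\varphi)\le i\}\subseteq\mathcal{C}(X,\Omega)$ is approximating, then $\mathcal{S}$ is expressive for $x$.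
   Context: A $\mathbf{CLat}_\sqcap$-fibration is a fibration $p\colon\mathcal{E}\to\mathcal{C}$ whose fibers are complete lattices (order $\sqsubseteq$, top $\top$, meets $\bigwedge$) with meet-preserving reindexing $f^*$. An expressivity situation $\mathcal{S}$ consists of such $p$; a functor $B\colon\mathcal{C}\to\mathcal{C}$; $\Omega\in\mathcal{C}$ with finite powers and $\underline{\Omega}\in\mathcal{E}$ above $\Omega$; a ranked alphabet $\Sigma$ with arrows $f_\sigma\colon\Omega^{\mathrm{rank}(\sigma)}\to\Omega$ each lifting to $g_\sigma\colon\underline{\Omega}^{\mathrm{rank}(\sigma)}\to\underline{\Omega}$ ($pg_\sigma=f_\sigma$); a set $\Lambda$ and arrows $\tau_\lambda\colon B\Omega\to\Omega$. Formulas of $L_{\mathcal{S}}$: $\varphi::=\sigma(\varphi_1,\dots,\varphi_{\mathrm{rank}(\sigma)})\mid\heartsuit_\lambda\varphi$, with semantics $[\![\sigma(\varphi_1,\dots,\varphi_n)]\!]_x=f_\sigma\circ\langle[\![\varphi_i]\!]_x\rangle_i$, $[\![\heartsuit_\lambda\varphi]\!]_x=\tau_\lambda\circ B[\![\varphi]\!]_x\circ x$. Depth: $\mathrm{depth}(\sigma(\varphi_1,\dots,\varphi_n))=\max_i\mathrm{depth}(\varphi_i)$ (0 if $n=0$), $\mathrm{depth}(\heartsuit_\lambda\varphi)=\mathrm{depth}(\varphi)+1$. Codensity lifting: $\overline{B}^{\underline{\Omega},\tau}P=\bigwedge_{\lambda\in\Lambda,\,h\in\mathcal{E}(P,\underline{\Omega})}(\tau_\lambda\circ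 B(ph))^*\underline{\Omega}$; codensity bisimilarity is the greatest fixed point of $x^*\circ\overline{B}^{\underline{\Omega},\tau}$ on $\mathcal{E}_X$. $\mathcal{S}$ is expressive for $x$ if codensity bisimilarity $\sqsupseteq\bigwedge_{\varphi\in L_{\mathcal{S}}}[\![\varphi]\!]_x^*\underline{\Omega}$. A subset $S\subseteq\mathcal{C}(X,\Omega)$ is approximating if for every $\mathcal{E}$-arrow $h\colon\bigwedge_{k\in S}k^*\underline{\Omega}\to\underline{\Omega}$ and every $\lambda\in\Lambda$, $\bigwedge_{k'\in S,\lambda'\in\Lambda}(\tau_{\lambda'}\circ Bk')^*\underline{\Omega}\sqsubseteq(\tau_\lambda\circ B(ph))^*\underline{\Omega}$. -}

module Defs where

open import Level using (Level; suc; Lift; lift)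
open import Data.Nat using (ℕ; zero; _≤_; _⊔_)
open import Data.Fin using (Fin)
open import Data.Vec.Functional using (foldr)
open import Data.Product using (Σ; _×_; _,_)
open import Data.Empty.Polymorphic using (⊥)
open import Relation.Binary.PropositionalEquality using (_≡_)

record Category (a : Level) : Set (suc a) where
  infixr 9 _∘_
  field
    Obj : Set a
    Hom : Obj → Obj → Set a
    id  : ∀ {X} → Hom X X
    _∘_ : ∀ {X Y Z} → Hom Y Z → Hom X Y → Hom X Z
    identityˡ : ∀ {X Y} (f : Hom X Y) → id ∘ f ≡ f
    identityʳ : ∀ {X Y} (f : Hom X Y) → f ∘ id ≡ f
    assoc : ∀ {W X Y Z} (h : Hom Y Z) (g : Hom X Y) (f : Hom W X) →
            (h ∘ g) ∘ f ≡ h ∘ (g ∘ f)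

record Endofunctor {a : Level} (C : Category a) : Set a where
  open Category C
  field
    F₀ : Obj → Obj
    F₁ : ∀ {X Y} → Hom X Y → Hom (F₀ X) (F₀ Y)
    F-id : ∀ {X} → F₁ (id {X}) ≡ id
    F-∘  : ∀ {X Y Z} (g : Hom Y Z) (f : Hom X Y) → F₁ (g ∘ f) ≡ F₁ g ∘ F₁ f

-- CLat_⊓-fibrations over C, presented (via the Grothendieck construction)
-- as a split indexed family of complete lattices with
-- meet-preserving reindexing.  Since the fibres are posets, an E-arrow
-- P → Q (P above X, Q above Y) is exactly an arrow f : X → Y of C with
-- P ⊑ f* Q, and p sends it to f.

record CLatFibration {a : Level} (C : Category a) : Set (suc a) where
  open Category C
  field
    Fib : Obj → Set a
    _⊑_ : ∀ {X} → Fib X → Fib X → Set a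
    ⊑-refl    : ∀ {X} (P : Fib X) → P ⊑ P
    ⊑-trans   : ∀ {X} {P Q R : Fib X} → P ⊑ Q → Q ⊑ R → P ⊑ R
    ⊑-antisym : ∀ {X} {P Q : Fib X} → P ⊑ Q → Q ⊑ P → P ≡ Q
    ⋀     : ∀ {X} {I : Set a} → (I → Fib X) → Fib X
    ⋀-lb  : ∀ {X} {I : Set a} (F : I → Fib X) (i : I) → ⋀ F ⊑ F i
    ⋀-glb : ∀ {X} {I : Set a} (F : I → Fib X) (P : Fib X) →
            (∀ i → P ⊑ F i) → P ⊑ ⋀ F
    reindex    : ∀ {X Y} → Hom X Y → Fib Y → Fib X
    reindex-id : ∀ {X} (P : Fib X) → reindex id P ≡ P
    reindex-∘  : ∀ {X Y Z} (g : Hom Y Z) (f : Hom X Y) (P : Fib Z) →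
                 reindex (g ∘ f) P ≡ reindex f (reindex g P)
    reindex-⋀  : ∀ {X Y} {I : Set a} (f : Hom X Y) (F : I → Fib Y) →
                 reindex f (⋀ F) ≡ ⋀ (λ i → reindex f (F i))

  ⊤ : ∀ {X} → Fib X
  ⊤ = ⋀ {I = ⊥} (λ ())

  ⋁ : ∀ {X} {I : Set a} → (I → Fib X) → Fib X
  ⋁ {X} {I} F = ⋀ {I = Σ (Fib X) (λ U → ∀ i → F i ⊑ U)} (λ { (U , _) → U })

  EArr : ∀ {X Y} → Fib X → Fib Y → Set a
  EArr {X} {Y} P Q = Σ (Hom X Y) (λ f → P ⊑ reindex f Q)

record Situation (a : Level) : Set (suc a) where
  open Level using (Lift; lift)
  field
    C : Category a
  open Category C public
  field
    fib : CLatFibration C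
    B   : Endofunctor C
  open CLatFibration fib public
  open Endofunctor B public
  field
    Ω : Obj
    pow   : ℕ → Obj
    proj  : ∀ {n} → Fin n → Hom (pow n) Ω
    tuple : ∀ {X n} → (Fin n → Hom X Ω) → Hom X (pow n)
    proj-tuple   : ∀ {X n} (fs : Fin n → Hom X Ω) (i : Fin n) →
                   proj i ∘ tuple fs ≡ fs i
    tuple-unique : ∀ {X n} (fs : Fin n → Hom X Ω) (g : Hom X (pow n)) →
                   (∀ i → proj i ∘ g ≡ fs i) → g ≡ tuple fs
    Ω̲ : Fib Ω
    Sig  : Set a
    rank : Sig → ℕ
    fσ   : (σ : Sig) → Hom (pow (rank σ)) Ω
  -- the n-th power of Ω̲ in E, lying above Ω^n (fibred product)
  Ω̲^ : (n : ℕ) → Fib (pow n)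
  Ω̲^ n = ⋀ {I = Lift a (Fin n)} (λ { (lift i) → reindex (proj i) Ω̲ })
  field
    -- each f_σ lifts to an E-arrow g_σ : Ω̲^rank(σ) → Ω̲
    gσ : (σ : Sig) → Ω̲^ (rank σ) ⊑ reindex (fσ σ) Ω̲
    Λ : Set a
    τ : Λ → Hom (F₀ Ω) Ω

module _ {a : Level} (𝒮 : Situation a) where
  open Situation 𝒮

  data Formula : Set a where
    op  : (σ : Sig) → (Fin (rank σ) → Formula) → Formula
    mod : Λ → Formula → Formula

  depth : Formula → ℕ
  depth (op σ φs) = foldr _⊔_ 0 (λ i → depth (φs i))
  depth (mod λ' φ) = Data.Nat.suc (depth φ)

  ⟦_⟧ : Formula → ∀ {X} → Hom X (F₀ X) → Hom X Ω
  ⟦ op σ φs ⟧ x = fσ σ ∘ tuple (λ i → ⟦ φs i ⟧ x)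
  ⟦ mod λ' φ ⟧ x = τ λ' ∘ F₁ (⟦ φ ⟧ x) ∘ x

  Bbar : ∀ {X} → Fib X → Fib (F₀ X)
  Bbar {X} P = ⋀ {I = Λ × EArr P Ω̲}
                 (λ { (λ' , (h , _)) → reindex (τ λ' ∘ F₁ h) Ω̲ })

  Φ : ∀ {X} → Hom X (F₀ X) → Fib X → Fib X
  Φ x P = reindex x (Bbar P)

  iter : ∀ {X} → Hom X (F₀ X) → ℕ → Fib X
  iter x zero = ⊤
  iter x (Data.Nat.suc i) = Φ x (iter x i)

  iterω : ∀ {X} → Hom X (F₀ X) → Fib X
  iterω x = ⋀ {I = Lift a ℕ} (λ { (lift i) → iter x i })

  StabilizesAtω : ∀ {X} → Hom X (F₀ X) → Set a
  StabilizesAtω x = Φ x (iterω x) ≡ iterω x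

  -- codensity bisimilarity: greatest fixed point of Φ (Knaster–Tarski:
  -- join of all post-fixed points)
  codensityBisim : ∀ {X} → Hom X (F₀ X) → Fib X
  codensityBisim {X} x =
    ⋁ {I = Σ (Fib X) (λ P → P ⊑ Φ x P)} (λ { (P , _) → P })

  Expressive : ∀ {X} → Hom X (F₀ X) → Set a
  Expressive x =
    ⋀ {I = Formula} (λ φ → reindex (⟦ φ ⟧ x) Ω̲) ⊑ codensityBisim x

  Approximating : ∀ {X} → (Hom X Ω → Set a) → Set a
  Approximating {X} S =
    (h : EArr (⋀ {I = Σ (Hom X Ω) S} (λ { (k , _) → reindex k Ω̲ })) Ω̲) →
    (λ' : Λ) →
    ⋀ {I = Σ (Hom X Ω) S × Λ} (λ { ((k' , _) , λ'') → reindex (τ λ'' ∘ F₁ k') Ω̲ })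
      ⊑ reindex (τ λ' ∘ F₁ (Σ.proj₁ h)) Ω̲

  DepthSet : ∀ {X} → Hom X (F₀ X) → ℕ → Hom X Ω → Set a
  DepthSet x i k = Σ Formula (λ φ → depth φ ≤ i × ⟦ φ ⟧ x ≡ k)

{-# OPTIONS --safe #-}
-- By induction on i, the meet of [[φ]]* Ω̲ over formulas of depth ≤ i lies below
-- Φⁱ(⊤): a test h on Φⁱ(⊤) restricts to the depth-i theory, and approximation
-- bounds the corresponding conjunct of B̄(Φⁱ(⊤)) by modal formulas of depth i + 1.
-- Hence the full theory lies below ⋀ᵢ Φⁱ(⊤), which by stabilization is a
-- (post-)fixed point and so lies below the greatest one.
module Submission where

open import Level using (Level; Lift; lift)
open import Data.Bool using (true; false; if_then_else_)
open import Data.Nat using (ℕ; zero; suc; s≤s)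
open import Data.Product using (Σ; _×_; _,_)
open import Relation.Binary.PropositionalEquality using (_≡_; refl; sym; trans; cong)
open import Defs

module CLatFibrationProperties {a : Level} {C : Category a} (fib : CLatFibration C) where
  open Category C
  open CLatFibration fib

  ≡⇒⊑ : ∀ {X} {P Q : Fib X} → P ≡ Q → P ⊑ Q
  ≡⇒⊑ {P = P} refl = ⊑-refl P

  ⊑-⊤ : ∀ {X} (P : Fib X) → P ⊑ ⊤
  ⊑-⊤ P = ⋀-glb _ P (λ ())

  ⋁-ub : ∀ {X} {I : Set a} (F : I → Fib X) (i : I) → F i ⊑ ⋁ F
  ⋁-ub F i = ⋀-glb _ (F i) (λ { (_ , F⊑U) → F⊑U i })

  _⊓_ : ∀ {X} → Fib X → Fib X → Fib X
  P ⊓ Q = ⋀ {I = Lift a _} (λ { (lift b) → if b then P else Q })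

  ⊑⇒≡⊓ : ∀ {X} {P Q : Fib X} → P ⊑ Q → P ≡ P ⊓ Q
  ⊑⇒≡⊓ {P = P} P⊑Q =
    ⊑-antisym (⋀-glb _ P (λ { (lift true) → ⊑-refl P ; (lift false) → P⊑Q }))
              (⋀-lb _ (lift true))

  -- Monotonicity comes from preservation of the binary meet P ⊓ Q = P.
  reindex-mono : ∀ {X Y} (f : Hom X Y) {P Q : Fib Y} → P ⊑ Q → reindex f P ⊑ reindex f Q
  reindex-mono f {P} {Q} P⊑Q =
    ⊑-trans (≡⇒⊑ (trans (cong (reindex f) (⊑⇒≡⊓ P⊑Q)) (reindex-⋀ f _)))
            (⋀-lb _ (lift false))

module _ {a : Level} (𝒮 : Situation a) {X : Situation.Obj 𝒮}
         (x : Situation.Hom 𝒮 X (Situation.F₀ 𝒮 X)) where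
  open Situation 𝒮
  open CLatFibrationProperties fib

  postFixed⊑codensityBisim : ∀ {P} → P ⊑ Φ 𝒮 x P → P ⊑ codensityBisim 𝒮 x
  postFixed⊑codensityBisim {P} P⊑ΦP = ⋁-ub _ (P , P⊑ΦP)

  theory : Fib X
  theory = ⋀ (λ φ → reindex (⟦_⟧ 𝒮 φ x) Ω̲)

  theoryOfDepth : ℕ → Fib X
  theoryOfDepth i = ⋀ {I = Σ (Hom X Ω) (DepthSet 𝒮 x i)} (λ { (k , _) → reindex k Ω̲ })

  modalTheoryOfDepth : ℕ → Fib (F₀ X)
  modalTheoryOfDepth i =
    ⋀ {I = Σ (Hom X Ω) (DepthSet 𝒮 x i) × Λ} (λ { ((k , _) , l) → reindex (τ l ∘ F₁ k) Ω̲ })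

  theory⊑theoryOfDepth : ∀ i → theory ⊑ theoryOfDepth i
  theory⊑theoryOfDepth i = ⋀-glb _ theory (λ { (_ , φ , _ , refl) → ⋀-lb _ φ })

  reindex-⟦mod⟧ : ∀ l φ →
    reindex (⟦_⟧ 𝒮 (mod l φ) x) Ω̲ ≡ reindex x (reindex (τ l ∘ F₁ (⟦_⟧ 𝒮 φ x)) Ω̲)
  reindex-⟦mod⟧ l φ =
    trans (cong (λ g → reindex g Ω̲) (sym (assoc (τ l) (F₁ (⟦_⟧ 𝒮 φ x)) x)))
          (reindex-∘ (τ l ∘ F₁ (⟦_⟧ 𝒮 φ x)) x Ω̲)

  theoryOfDepth-suc⊑modal : ∀ i → theoryOfDepth (suc i) ⊑ reindex x (modalTheoryOfDepth i)
  theoryOfDepth-suc⊑modal i =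
    ⊑-trans (⋀-glb _ _ (λ { ((_ , φ , d , refl) , l) →
               ⊑-trans (⋀-lb _ (_ , mod l φ , s≤s d , refl)) (≡⇒⊑ (reindex-⟦mod⟧ l φ)) }))
            (≡⇒⊑ (sym (reindex-⋀ x _)))

  theoryOfDepth⊑iter : ((i : ℕ) → Approximating 𝒮 (DepthSet 𝒮 x i)) →
                       ∀ i → theoryOfDepth i ⊑ iter 𝒮 x i
  theoryOfDepth⊑iter appr zero = ⊑-⊤ _
  theoryOfDepth⊑iter appr (suc i) =
    ⊑-trans (theoryOfDepth-suc⊑modal i) (reindex-mono x modal⊑Bbar)
    where
    modal⊑Bbar : modalTheoryOfDepth i ⊑ Bbar 𝒮 (iter 𝒮 x i)
    modal⊑Bbar = ⋀-glb _ _ (λ { (l , h , iter⊑h*Ω̲) →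
      appr i (h , ⊑-trans (theoryOfDepth⊑iter appr i) iter⊑h*Ω̲) l })

mainTheorem3 : ∀ {a} (𝒮 : Situation a) {X : Situation.Obj 𝒮}
    (x : Situation.Hom 𝒮 X (Situation.F₀ 𝒮 X)) →
    StabilizesAtω 𝒮 x →
    ((i : ℕ) → Approximating 𝒮 (DepthSet 𝒮 x i)) →
    Expressive 𝒮 x
mainTheorem3 𝒮 x stab appr =
  ⊑-trans theory⊑iterω (postFixed⊑codensityBisim 𝒮 x (≡⇒⊑ (sym stab)))
  where
  open Situation 𝒮
  open CLatFibrationProperties fib
  theory⊑iterω : theory 𝒮 x ⊑ iterω 𝒮 x
  theory⊑iterω = ⋀-glb _ _ (λ { (lift i) →
    ⊑-trans (theory⊑theoryOfDepth 𝒮 x i) (theoryOfDepth⊑iter 𝒮 x appr i) })
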